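{- Let $r=(p,q)$ be a special pattern rule, with witnesses as in the definition of special pattern rules below and associated $k$ and $\alpha(r)$. Then for every $n\in\mathbb N$ with $n\ge\alpha(r)$ there exists $\eta\in S(\Sigma,X)$ such that $q(n)=p(n+k)\eta$.
   Context: Fix a signature $\Sigma$, hole constants $\square_1,\square_2,\dots$ and an infinite countable set $X$ of variables, pairwise disjoint. $T(\Sigma,X)$ is the set of terms, $S(\Sigma,X)$ the set of substitutions; composition $x(\sigma\theta)=(x\sigma)\theta$, $\emptyset$ identity, $\sigma^0=\emptyset$, $\sigma^{n+1}=\sigma^n\sigma$. An $m$-context is a term over $\Sigma\cup\{\square_i\}$ and $X$ containing $\square_1,\dots,\square_m$ and no other hole; $c(s_1,\dots,s_m)$ replaces each $\square_i$ by $s_i$; for a 1-context $c$, $c^0=\square_1$, $c^{n+1}=c(c^n)$; $\chi^{(1)}$ is the set of 1-contexts without variables. $\Upsilon$ is a set of new unary symbols $c^{a,b}$ ($c\in\chi^{(1)}$, $a,b\in\mathbb N$); for $u\in T(\Sigma\cup\Upsilon,X)$, $u(n)$ replaces each $c^{a,b}$ by the nesting $c^{a\times n+b}$; $u\sim v$ iff $u(n)=v(n)$ for all $n$, $[u]$ is its class. A pattern term is $p=(s,(\sigma,\mu))$, $s\in T(\Sigma,X)$, $\sigma,\mu\in S(\Sigma,X)$, with $p(n)=s\sigma^n\mu$. It is simple if for each $x\in\mathit{Var}(s)$, $\sigma(x)=c^a(x)$ and $\mu(x)=c^b(t)$ for some $c\in\chi^{(1)}$, $a,b\in\mathbb N$,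 $t\in T(\Sigma,X)$; then $\upsilon(p)=[s\theta_p]$ with $\theta_p(x)=\mu(x)$ if $\sigma(x)=x$ and $\theta_p(x)=c^{a,b}(t)$ otherwise. A pattern rule (pair of pattern terms) is simple if both components are. A pattern rule $r=(p,q)$ is special if it is simple and there exist an $m$-context $c$ with $\mathit{Var}(c)=\emptyset$, $c_1,\dots,c_m\in\chi^{(1)}$, naturals $a_i,b_i,a'_i,b'_i$, terms $t_1,\dots,t_m\in T(\Sigma,X)$ and $\rho\in S(\Sigma,X)$ with $c(c_1^{a_1,b_1}(t_1),\dots,c_m^{a_m,b_m}(t_m))\in\upsilon(p)$ and $c(c_1^{a'_1,b'_1}(t_1\rho),\dots,c_m^{a'_m,b'_m}(t_m\rho))\in\upsilon(q)$ such that: (1) each $t_i$ is a variable or a ground term; (2) if $t_i\in X$ and $t_i=t_j$ then $c_i=c_j$; (3) $\{(a_i,a'_i)\mid t_i\text{ ground}\}=\{(h,h)\}$ for some $h>0$ and $\{(a_i,a'_i)\mid t_i\in X\}=\{(a,a')\}$ with $a\le a'$; (4) $\{(b_i,b'_i)\mid t_i\text{ ground}\}=\{(b,b')\}$ with $b\le b'$ and $\{(b_i,b'_i)\mid t_i\in X\}=\{(d,d')\}$; (5) $k=(b'-b)/h\in\mathbb N$, and $a=a'$ implies $0\le(d'-d)-a\times k$. Then $\alpha(r)=0$ if $a=a'$ and $\alpha(r)=\frac{a\times k-(d'-d)}{a'-a}$ otherwise. -}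

module Defs where

open import Data.Nat using (ℕ; zero; suc; _+_; _*_; _∸_; _≤_; _<_)
open import Data.Nat.Properties using (_≟_)
open import Data.Fin using (Fin)
open import Data.Vec using (Vec; []; _∷_; lookup)
open import Data.Empty using (⊥)
open import Data.Unit using (⊤; tt)
open import Data.Product using (Σ; Σ-syntax; ∃; ∃-syntax; _×_; _,_; proj₁)
open import Data.Sum using (_⊎_)
open import Relation.Nullary using (¬_; yes; no)
open import Relation.Binary.PropositionalEquality using (_≡_; _≢_)
open import Data.Integer using (ℤ; +_; _-_) renaming (_≤_ to _≤ℤ_; 0ℤ to 0ℤ)
open import Data.Rational using (ℚ; _/_; 0ℚ)

record Signature : Set₁ where
  field
    Sym : Set
    ar  : Sym → ℕ
open Signature public

module _ (Sg : Signature) where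

  -- T(Σ,X) = Tm ℕ ⊥  (X = ℕ, countably infinite, no holes)
  -- ground m-context (Var = ∅) = Tm ⊥ (Fin m)   (hole i stands for □_{i+1})
  -- ground 1-context = Tm ⊥ ⊤

  data Tm (V H : Set) : Set where
    var  : V → Tm V H
    hole : H → Tm V H
    fn   : (f : Sym Sg) → Vec (Tm V H) (ar Sg f) → Tm V H

  mutual
    bind : {V H V' H' : Set} → (V → Tm V' H') → (H → Tm V' H') → Tm V H → Tm V' H'
    bind f g (var x)   = f x
    bind f g (hole h)  = g h
    bind f g (fn s ts) = fn s (binds f g ts)

    binds : {V H V' H' : Set} {n : ℕ} → (V → Tm V' H') → (H → Tm V' H') →
            Vec (Tm V H) n → Vec (Tm V' H') n
    binds f g []       = []
    binds f g (t ∷ ts) = bind f g t ∷ binds f g ts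

  data HoleIn {V H : Set} (h : H) : Tm V H → Set where
    here  : HoleIn h (hole h)
    there : ∀ {f ts} (i : Fin (ar Sg f)) → HoleIn h (lookup ts i) → HoleIn h (fn f ts)

  data VarIn {V H : Set} (x : V) : Tm V H → Set where
    here  : VarIn x (var x)
    there : ∀ {f ts} (i : Fin (ar Sg f)) → VarIn x (lookup ts i) → VarIn x (fn f ts)

  T : Set
  T = Tm ℕ ⊥

  noHole : {A : Set} → ⊥ → A
  noHole ()

  Subst : Set
  Subst = ℕ → T

  _⟪_⟫ : T → Subst → T
  t ⟪ σ ⟫ = bind σ noHole t

  _∘ₛ_ : Subst → Subst → Subst
  (σ ∘ₛ θ) x = (σ x) ⟪ θ ⟫

  idₛ : Subst
  idₛ = var

  _^ₛ_ : Subst → ℕ → Subst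
  σ ^ₛ zero  = idₛ
  σ ^ₛ suc n = (σ ^ₛ n) ∘ₛ σ

  Ctx1 : Set
  Ctx1 = Tm ⊥ ⊤

  χ1 : Set
  χ1 = Σ[ c ∈ Ctx1 ] HoleIn tt c

  _[_]₁ : Ctx1 → T → T
  c [ s ]₁ = bind noHole (λ _ → s) c

  _^c_ : Ctx1 → ℕ → Ctx1
  c ^c zero  = hole tt
  c ^c suc n = bind noHole (λ _ → c ^c n) c

  -- Terms over Σ ∪ Υ, Υ = { c^{a,b} | c ∈ χ^(1), a b ∈ ℕ } (unary)

  data UTm : Set where
    var : ℕ → UTm
    fn  : (f : Sym Sg) → Vec UTm (ar Sg f) → UTm
    ups : χ1 → ℕ → ℕ → UTm → UTm

  mutual
    evalU : ℕ → UTm → T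
    evalU n (var x)       = var x
    evalU n (fn f us)     = fn f (evalUs n us)
    evalU n (ups c a b u) = (proj₁ c ^c (a * n + b)) [ evalU n u ]₁

    evalUs : {k : ℕ} → ℕ → Vec UTm k → Vec T k
    evalUs n []       = []
    evalUs n (u ∷ us) = evalU n u ∷ evalUs n us

  _∼_ : UTm → UTm → Set
  u ∼ v = ∀ n → evalU n u ≡ evalU n v

  mutual
    toU : {V H : Set} → (V → UTm) → (H → UTm) → Tm V H → UTm
    toU f g (var x)   = f x
    toU f g (hole h)  = g h
    toU f g (fn s ts) = fn s (toUs f g ts)

    toUs : {V H : Set} {n : ℕ} → (V → UTm) → (H → UTm) → Vec (Tm V H) n → Vec UTm n
    toUs f g []       = []
    toUs f g (t ∷ ts) = toU f g t ∷ toUs f g ts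

  embU : T → UTm
  embU = toU var noHole

  plugU : {m : ℕ} → Tm ⊥ (Fin m) → (Fin m → UTm) → UTm
  plugU c us = toU noHole us c

  record PTerm : Set where
    constructor ⟨_,_,_⟩
    field
      s : T
      σ : Subst
      μ : Subst

  _⦅_⦆ : PTerm → ℕ → T
  p ⦅ n ⦆ = PTerm.s p ⟪ (PTerm.σ p ^ₛ n) ∘ₛ PTerm.μ p ⟫

  Simple : PTerm → Set
  Simple ⟨ s , σ , μ ⟩ = ∀ x → VarIn x s →
    Σ[ c ∈ χ1 ] Σ[ a ∈ ℕ ] Σ[ b ∈ ℕ ] Σ[ t ∈ T ]
      (σ x ≡ (proj₁ c ^c a) [ var x ]₁) × (μ x ≡ (proj₁ c ^c b) [ t ]₁)

  ThetaP : PTerm → ℕ → UTm → Set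
  ThetaP ⟨ s , σ , μ ⟩ x u =
      (σ x ≡ var x × u ≡ embU (μ x))
    ⊎ (σ x ≢ var x ×
        (Σ[ c ∈ χ1 ] Σ[ a ∈ ℕ ] Σ[ b ∈ ℕ ] Σ[ t ∈ T ]
          (σ x ≡ (proj₁ c ^c a) [ var x ]₁) × (μ x ≡ (proj₁ c ^c b) [ t ]₁)
          × (u ≡ ups c a b (embU t))))

  _∈υ_ : UTm → PTerm → Set
  u ∈υ p = Σ[ θ ∈ (ℕ → UTm) ]
    (∀ x → VarIn x (PTerm.s p) → ThetaP p x (θ x)) × (u ∼ toU θ noHole (PTerm.s p))

  Ground : T → Set
  Ground t = ∀ x → ¬ VarIn x t

  IsVar : T → Set
  IsVar t = ∃[ x ] (t ≡ var x)

  alpha : (a a' k d d' : ℕ) → ℚ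
  alpha a a' k d d' with a ≟ a'
  ... | yes _ = 0ℚ
  ... | no  _ = frac (a' ∸ a)
    where
    frac : ℕ → ℚ
    frac zero    = 0ℚ     -- unreachable when a ≤ a' and a ≢ a'
    frac (suc j) = ((+ (a * k)) - ((+ d') - (+ d))) / suc j

  record SpecialWitness (p q : PTerm) : Set where
    field
      simple-p : Simple p
      simple-q : Simple q
      m    : ℕ
      c    : Tm ⊥ (Fin m)
      c-holes : ∀ (i : Fin m) → HoleIn i c
      cs   : Fin m → χ1
      as bs as' bs' : Fin m → ℕ
      ts   : Fin m → T
      ρ    : Subst
      inP  : plugU c (λ i → ups (cs i) (as i) (bs i) (embU (ts i))) ∈υ p
      inQ  : plugU c (λ i → ups (cs i) (as' i) (bs' i) (embU (ts i ⟪ ρ ⟫))) ∈υ q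
      var-or-ground : ∀ i → IsVar (ts i) ⊎ Ground (ts i)
      same-var-same-ctx : ∀ i j x → ts i ≡ var x → ts j ≡ var x → proj₁ (cs i) ≡ proj₁ (cs j)
      h : ℕ
      h>0 : 0 < h
      ground-exists : ∃[ i ] Ground (ts i)
      ground-a : ∀ i → Ground (ts i) → as i ≡ h × as' i ≡ h
      a a' : ℕ
      var-exists : ∃[ i ] IsVar (ts i)
      var-a : ∀ i → IsVar (ts i) → as i ≡ a × as' i ≡ a'
      a≤a' : a ≤ a'
      b b' : ℕ
      ground-b : ∀ i → Ground (ts i) → bs i ≡ b × bs' i ≡ b'
      b≤b' : b ≤ b'
      d d' : ℕ
      var-b : ∀ i → IsVar (ts i) → bs i ≡ d × bs' i ≡ d'
      k : ℕ
      k-def : k * h ≡ b' ∸ b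
      a≡a'⇒ : a ≡ a' → 0ℤ ≤ℤ (((+ d') - (+ d)) - (+ (a * k)))

    α : ℚ
    α = alpha a a' k d d'

-- Both q(n) and p(n+k) instantiate the ground context c; at hole i they hold
-- c_i^(a'_i n + b'_i)(t_i ρ) and c_i^(a_i (n+k) + b_i)(t_i) respectively. For ground t_i the
-- exponents agree because h k = b' − b. For a variable t_i = x the hypothesis n ≥ α(r) says
-- exactly that a (n+k) + d ≤ a' n + d', so η(x) = c_i^gap(ρ x), with gap the difference of the
-- exponents, matches the two sides; by condition (2) c_i depends only on x.
module Submission where

open import Defs
open import Data.Nat using (ℕ; zero; suc; _+_; _*_; _∸_) renaming (_≤_ to _≤ℕ_)
open import Data.Nat.Properties as ℕ using (_≟_)
open import Data.Nat.Tactic.RingSolver as ℕ-Solver using ()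
open import Data.Integer as ℤ using (ℤ; +_; 0ℤ)
open import Data.Integer.Properties as ℤ using ()
open import Data.Integer.Tactic.RingSolver as ℤ-Solver using ()
open import Data.Rational using (_≤_; _/_)
open import Data.Rational.Properties as ℚ using ()
open import Data.Rational.Unnormalised as ℚᵘ using (mkℚᵘ; *≤*)
open import Data.Rational.Unnormalised.Properties as ℚᵘ using ()
open import Data.Fin using (Fin; zero; suc)
open import Data.Fin.Properties using (any?)
open import Data.Vec using (Vec; []; _∷_; lookup)
open import Data.Empty using (⊥; ⊥-elim)
open import Data.Product using (∃-syntax; _,_; proj₁)
open import Data.Sum using (inj₁; inj₂; [_,_]′)
open import Relation.Nullary using (Dec; yes; no)
open import Relation.Binary.PropositionalEquality
  using (_≡_; refl; sym; trans; cong; cong₂; subst₂; module ≡-Reasoning)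

drop-/≤/ : ∀ (i j : ℤ) (l m : ℕ) → i / suc l ≤ j / suc m → i ℤ.* + suc m ℤ.≤ j ℤ.* + suc l
drop-/≤/ i j l m i/l≤j/m
  with ℚᵘ.≤-respˡ-≃ (ℚ.toℚᵘ-fromℚᵘ (mkℚᵘ i l))
         (ℚᵘ.≤-respʳ-≃ (ℚ.toℚᵘ-fromℚᵘ (mkℚᵘ j m)) (ℚ.toℚᵘ-mono-≤ i/l≤j/m))
... | *≤* le = le

x-[y-z]≤m⇒x+z≤m+y : ∀ x y z m → + x ℤ.- (+ y ℤ.- + z) ℤ.≤ + m → x + z ≤ℕ m + y
x-[y-z]≤m⇒x+z≤m+y x y z m le = ℤ.drop‿+≤+ (begin
  + (x + z)                            ≡⟨ ℤ.pos-+ x z ⟩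
  + x ℤ.+ + z                          ≡⟨ rearrange (+ x) (+ y) (+ z) ⟩
  (+ x ℤ.- (+ y ℤ.- + z)) ℤ.+ + y      ≤⟨ ℤ.+-monoˡ-≤ (+ y) le ⟩
  + m ℤ.+ + y                          ≡⟨ ℤ.pos-+ m y ⟨
  + (m + y)                            ∎)
  where
  open ℤ.≤-Reasoning
  rearrange : ∀ x y z → x ℤ.+ z ≡ (x ℤ.- (y ℤ.- z)) ℤ.+ y
  rearrange = ℤ-Solver.solve-∀

a*[n+k]+d≤a'*n+d' : ∀ {a' d'} a s k d n → a + s ≡ a' → a * k + d ≤ℕ s * n + d' →
                    a * (n + k) + d ≤ℕ a' * n + d'
a*[n+k]+d≤a'*n+d' {a'} {d'} a s k d n a+s≡a' le = begin
  a * (n + k) + d       ≡⟨ distrib a n k d ⟩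
  a * n + (a * k + d)   ≤⟨ ℕ.+-monoʳ-≤ (a * n) le ⟩
  a * n + (s * n + d')  ≡⟨ collect a s n d' ⟩
  (a + s) * n + d'      ≡⟨ cong (λ a' → a' * n + d') a+s≡a' ⟩
  a' * n + d'           ∎
  where
  open ℕ.≤-Reasoning
  distrib : ∀ a n k d → a * (n + k) + d ≡ a * n + (a * k + d)
  distrib = ℕ-Solver.solve-∀
  collect : ∀ a s n d' → a * n + (s * n + d') ≡ (a + s) * n + d'
  collect = ℕ-Solver.solve-∀

h*n+b'≡h*[n+k]+b : ∀ {b b'} h n k → k * h ≡ b' ∸ b → b ≤ℕ b' → h * n + b' ≡ h * (n + k) + b
h*n+b'≡h*[n+k]+b {b} {b'} h n k k*h≡b'∸b b≤b' = begin
  h * n + b'              ≡⟨ cong (λ x → h * n + x) (ℕ.m∸n+n≡m b≤b') ⟨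
  h * n + (b' ∸ b + b)    ≡⟨ cong (λ x → h * n + (x + b)) (trans (sym k*h≡b'∸b) (ℕ.*-comm k h)) ⟩
  h * n + (h * k + b)     ≡⟨ ℕ.+-assoc (h * n) (h * k) b ⟨
  h * n + h * k + b       ≡⟨ cong (λ x → x + b) (ℕ.*-distribˡ-+ h n k) ⟨
  h * (n + k) + b         ∎
  where open ≡-Reasoning

private
  variable
    V H V' H' V'' H'' : Set

module _ (Sg : Signature) where

  alpha≤⇒a*[n+k]+d≤a'*n+d' : ∀ {a a' k d d'} n → a ≤ℕ a' →
                              (a ≡ a' → 0ℤ ℤ.≤ ((+ d' ℤ.- + d) ℤ.- + (a * k))) →
                              alpha Sg a a' k d d' ≤ + n / 1 → a * (n + k) + d ≤ℕ a' * n + d'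
  alpha≤⇒a*[n+k]+d≤a'*n+d' {a} {a'} {k} {d} {d'} n a≤a' a≡a'⇒0≤ α≤n with a ≟ a'
  ... | yes refl =
    a*[n+k]+d≤a'*n+d' a 0 k d n (ℕ.+-identityʳ a) (x-[y-z]≤m⇒x+z≤m+y (a * k) d' d 0 slack)
    where
    slack : + (a * k) ℤ.- (+ d' ℤ.- + d) ℤ.≤ 0ℤ
    slack = ℤ.i≤j⇒i-j≤0 (ℤ.0≤i-j⇒j≤i {+ d' ℤ.- + d} (a≡a'⇒0≤ refl))
  ... | no a≢a' with a' ∸ a in a'∸a≡
  ...   | zero  = ⊥-elim (a≢a' (ℕ.≤-antisym a≤a' (ℕ.m∸n≡0⇒m≤n a'∸a≡)))
  ...   | suc j =
    a*[n+k]+d≤a'*n+d' a (suc j) k d n a+[1+j]≡a' (x-[y-z]≤m⇒x+z≤m+y (a * k) d' d (suc j * n) slack)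
    where
    a+[1+j]≡a' : a + suc j ≡ a'
    a+[1+j]≡a' = trans (cong (λ s → a + s) (sym a'∸a≡)) (ℕ.m+[n∸m]≡n a≤a')
    n*[1+j]≡ : + n ℤ.* + suc j ≡ + (suc j * n)
    n*[1+j]≡ = trans (ℤ.*-comm (+ n) (+ suc j)) (sym (ℤ.pos-* (suc j) n))
    slack : + (a * k) ℤ.- (+ d' ℤ.- + d) ℤ.≤ + (suc j * n)
    slack = subst₂ ℤ._≤_ (ℤ.*-identityʳ _) n*[1+j]≡
                   (drop-/≤/ (+ (a * k) ℤ.- (+ d' ℤ.- + d)) (+ n) j 0 α≤n)

  mutual
    bind-cong : {f f' : V → Tm Sg V' H'} {g g' : H → Tm Sg V' H'} (t : Tm Sg V H) →
                (∀ x → VarIn Sg x t → f x ≡ f' x) → (∀ h → g h ≡ g' h) →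
                bind Sg f g t ≡ bind Sg f' g' t
    bind-cong (var x)   f≗f' g≗g' = f≗f' x here
    bind-cong (hole h)  f≗f' g≗g' = g≗g' h
    bind-cong (fn s ts) f≗f' g≗g' =
      cong (fn s) (binds-cong ts (λ x i x∈tᵢ → f≗f' x (there i x∈tᵢ)) g≗g')

    binds-cong : ∀ {m} {f f' : V → Tm Sg V' H'} {g g' : H → Tm Sg V' H'}
                 (ts : Vec (Tm Sg V H) m) →
                 (∀ x i → VarIn Sg x (lookup ts i) → f x ≡ f' x) → (∀ h → g h ≡ g' h) →
                 binds Sg f g ts ≡ binds Sg f' g' ts
    binds-cong []       f≗f' g≗g' = refl
    binds-cong (t ∷ ts) f≗f' g≗g' =
      cong₂ _∷_ (bind-cong t (λ x → f≗f' x zero) g≗g')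
                (binds-cong ts (λ x i → f≗f' x (suc i)) g≗g')

  mutual
    bind-bind : (f : V → Tm Sg V' H') (g : H → Tm Sg V' H')
                (f' : V' → Tm Sg V'' H'') (g' : H' → Tm Sg V'' H'') (t : Tm Sg V H) →
                bind Sg f' g' (bind Sg f g t) ≡
                bind Sg (λ x → bind Sg f' g' (f x)) (λ h → bind Sg f' g' (g h)) t
    bind-bind f g f' g' (var x)   = refl
    bind-bind f g f' g' (hole h)  = refl
    bind-bind f g f' g' (fn s ts) = cong (fn s) (binds-binds f g f' g' ts)

    binds-binds : ∀ {m} (f : V → Tm Sg V' H') (g : H → Tm Sg V' H')
                  (f' : V' → Tm Sg V'' H'') (g' : H' → Tm Sg V'' H'') (ts : Vec (Tm Sg V H) m) →
                  binds Sg f' g' (binds Sg f g ts) ≡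
                  binds Sg (λ x → bind Sg f' g' (f x)) (λ h → bind Sg f' g' (g h)) ts
    binds-binds f g f' g' []       = refl
    binds-binds f g f' g' (t ∷ ts) = cong₂ _∷_ (bind-bind f g f' g' t) (binds-binds f g f' g' ts)

  mutual
    bind-identity : (t : Tm Sg V H) → bind Sg var hole t ≡ t
    bind-identity (var x)   = refl
    bind-identity (hole h)  = refl
    bind-identity (fn s ts) = cong (fn s) (binds-identity ts)

    binds-identity : ∀ {m} (ts : Vec (Tm Sg V H) m) → binds Sg var hole ts ≡ ts
    binds-identity []       = refl
    binds-identity (t ∷ ts) = cong₂ _∷_ (bind-identity t) (binds-identity ts)

  mutual
    evalU-toU : ∀ n (f : V → UTm Sg) (g : H → UTm Sg) (t : Tm Sg V H) →
                evalU Sg n (toU Sg f g t) ≡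
                bind Sg (λ x → evalU Sg n (f x)) (λ h → evalU Sg n (g h)) t
    evalU-toU n f g (var x)   = refl
    evalU-toU n f g (hole h)  = refl
    evalU-toU n f g (fn s ts) = cong (fn s) (evalUs-toUs n f g ts)

    evalUs-toUs : ∀ {m} n (f : V → UTm Sg) (g : H → UTm Sg) (ts : Vec (Tm Sg V H) m) →
                  evalUs Sg n (toUs Sg f g ts) ≡
                  binds Sg (λ x → evalU Sg n (f x)) (λ h → evalU Sg n (g h)) ts
    evalUs-toUs n f g []       = refl
    evalUs-toUs n f g (t ∷ ts) = cong₂ _∷_ (evalU-toU n f g t) (evalUs-toUs n f g ts)

  private
    infix  8 _[_]
    infixl 9 _^_
    infixl 7 _⟨_⟩

    _⟨_⟩ : T Sg → Subst Sg → T Sg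
    _⟨_⟩ = _⟪_⟫ Sg

    _[_] : Ctx1 Sg → T Sg → T Sg
    _[_] = _[_]₁ Sg

    _^_ : Ctx1 Sg → ℕ → Ctx1 Sg
    _^_ = _^c_ Sg

  infixl 8 _⟦_⟧

  _⟦_⟧ : Tm Sg ⊥ H → (H → Tm Sg V H') → Tm Sg V H'
  c ⟦ g ⟧ = bind Sg (noHole Sg) g c

  ⟦⟧-⟨⟩ : (c : Tm Sg ⊥ H) (g : H → T Sg) (η : Subst Sg) →
          c ⟦ g ⟧ ⟨ η ⟩ ≡ c ⟦ (λ h → g h ⟨ η ⟩) ⟧
  ⟦⟧-⟨⟩ c g η = trans (bind-bind (noHole Sg) g η (noHole Sg) c) (bind-cong c (λ ()) (λ _ → refl))

  evalU-plugU : ∀ {m} n (c : Tm Sg ⊥ (Fin m)) (us : Fin m → UTm Sg) →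
                evalU Sg n (plugU Sg c us) ≡ c ⟦ (λ i → evalU Sg n (us i)) ⟧
  evalU-plugU n c us = trans (evalU-toU n (noHole Sg) us c) (bind-cong c (λ ()) (λ _ → refl))

  evalU-embU : ∀ n (t : T Sg) → evalU Sg n (embU Sg t) ≡ t
  evalU-embU n t =
    trans (evalU-toU n var (noHole Sg) t) (trans (bind-cong t (λ _ _ → refl) (λ ())) (bind-identity t))

  ground-⟨⟩ : ∀ {t} → Ground Sg t → (η : Subst Sg) → t ⟨ η ⟩ ≡ t
  ground-⟨⟩ {t} ground η =
    trans (bind-cong t (λ x x∈t → ⊥-elim (ground x x∈t)) (λ ())) (bind-identity t)

  ^-suc : ∀ C e v → C ^ suc e [ v ] ≡ C [ C ^ e [ v ] ]
  ^-suc C e v = trans (bind-bind (noHole Sg) _ (noHole Sg) _ C) (bind-cong C (λ ()) (λ _ → refl))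

  ^-+ : ∀ C e e' v → C ^ e [ C ^ e' [ v ] ] ≡ C ^ (e + e') [ v ]
  ^-+ C zero    e' v = refl
  ^-+ C (suc e) e' v = begin
    C ^ suc e [ C ^ e' [ v ] ]   ≡⟨ ^-suc C e _ ⟩
    C [ C ^ e [ C ^ e' [ v ] ] ] ≡⟨ cong (C [_]) (^-+ C e e' v) ⟩
    C [ C ^ (e + e') [ v ] ]     ≡⟨ ^-suc C (e + e') v ⟨
    C ^ suc (e + e') [ v ]       ∎
    where open ≡-Reasoning

  ^ₛ-fixed : ∀ {σ x} → σ x ≡ var x → ∀ n → _^ₛ_ Sg σ n x ≡ var x
  ^ₛ-fixed σx≡x zero    = refl
  ^ₛ-fixed σx≡x (suc n) = trans (cong (_⟨ _ ⟩) (^ₛ-fixed σx≡x n)) σx≡x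

  ^ₛ-iterate : ∀ {σ x} C a → σ x ≡ C ^ a [ var x ] →
               ∀ n → _^ₛ_ Sg σ n x ≡ C ^ (a * n) [ var x ]
  ^ₛ-iterate {σ} {x} C a σx≡ zero = cong (λ e → C ^ e [ var x ]) (sym (ℕ.*-zeroʳ a))
  ^ₛ-iterate {σ} {x} C a σx≡ (suc n) = begin
    _^ₛ_ Sg σ n x ⟨ σ ⟩              ≡⟨ cong _⟨ σ ⟩ (^ₛ-iterate C a σx≡ n) ⟩
    C ^ (a * n) [ var x ] ⟨ σ ⟩      ≡⟨ ⟦⟧-⟨⟩ (C ^ (a * n)) _ σ ⟩
    C ^ (a * n) [ σ x ]              ≡⟨ cong (C ^ (a * n) [_]) σx≡ ⟩
    C ^ (a * n) [ C ^ a [ var x ] ]  ≡⟨ ^-+ C (a * n) a (var x) ⟩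
    C ^ (a * n + a) [ var x ]        ≡⟨ cong (λ e → C ^ e [ var x ]) a*n+a≡a*[1+n] ⟩
    C ^ (a * suc n) [ var x ]        ∎
    where
    open ≡-Reasoning
    a*n+a≡a*[1+n] : a * n + a ≡ a * suc n
    a*n+a≡a*[1+n] = trans (ℕ.+-comm (a * n) a) (sym (ℕ.*-suc a n))

  thetaP-eval : ∀ {s σ μ x u} → ThetaP Sg ⟨ s , σ , μ ⟩ x u →
                ∀ n → evalU Sg n u ≡ _^ₛ_ Sg σ n x ⟨ μ ⟩
  thetaP-eval {σ = σ} {μ} {x} (inj₁ (σx≡x , refl)) n =
    trans (evalU-embU n (μ x)) (cong _⟨ μ ⟩ (sym (^ₛ-fixed σx≡x n)))
  thetaP-eval {σ = σ} {μ} {x} (inj₂ (_ , (C , _) , a , b , t , σx≡ , μx≡ , refl)) n = begin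
    C ^ (a * n + b) [ evalU Sg n (embU Sg t) ] ≡⟨ cong (C ^ (a * n + b) [_]) (evalU-embU n t) ⟩
    C ^ (a * n + b) [ t ]                      ≡⟨ ^-+ C (a * n) b t ⟨
    C ^ (a * n) [ C ^ b [ t ] ]                ≡⟨ cong (C ^ (a * n) [_]) μx≡ ⟨
    C ^ (a * n) [ μ x ]                        ≡⟨ ⟦⟧-⟨⟩ (C ^ (a * n)) _ μ ⟨
    C ^ (a * n) [ var x ] ⟨ μ ⟩                ≡⟨ cong _⟨ μ ⟩ (^ₛ-iterate C a σx≡ n) ⟨
    _^ₛ_ Sg σ n x ⟨ μ ⟩                        ∎
    where open ≡-Reasoning

  ∈υ-eval : ∀ {u p} → _∈υ_ Sg u p → ∀ n → _⦅_⦆ Sg p n ≡ evalU Sg n u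
  ∈υ-eval {u} {⟨ s , σ , μ ⟩} (θ , θ-ok , u∼sθ) n = sym (begin
    evalU Sg n u                                                   ≡⟨ u∼sθ n ⟩
    evalU Sg n (toU Sg θ (noHole Sg) s)                            ≡⟨ evalU-toU n θ (noHole Sg) s ⟩
    bind Sg (λ x → evalU Sg n (θ x)) (λ h → evalU Sg n (noHole Sg h)) s
      ≡⟨ bind-cong s (λ x x∈s → thetaP-eval {s} (θ-ok x x∈s) n) (λ ()) ⟩
    _⦅_⦆ Sg ⟨ s , σ , μ ⟩ n                                        ∎)
    where open ≡-Reasoning

  is-var? : (t : T Sg) (x : ℕ) → Dec (t ≡ var x)
  is-var? (var y) x with y ≟ x
  ... | yes refl = yes refl
  ... | no y≢x   = no λ { refl → y≢x refl }
  is-var? (fn f ts) x = no λ ()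

  module SpecialRule {p q : PTerm Sg} (w : SpecialWitness Sg p q) (n : ℕ)
                     (α≤n : SpecialWitness.α w ≤ + n / 1) where

    open SpecialWitness w

    var-exponents-≤ : a * (n + k) + d ≤ℕ a' * n + d'
    var-exponents-≤ = alpha≤⇒a*[n+k]+d≤a'*n+d' n a≤a' a≡a'⇒ α≤n

    gap : ℕ
    gap = (a' * n + d') ∸ (a * (n + k) + d)

    ctx : Fin m → Ctx1 Sg
    ctx i = proj₁ (cs i)

    η : Subst Sg
    η x with any? (λ j → is-var? (ts j) x)
    ... | yes (j , _) = ctx j ^ gap [ ρ x ]
    ... | no _        = var x

    η-var : ∀ {i x} → ts i ≡ var x → η x ≡ ctx i ^ gap [ ρ x ]
    η-var {i} {x} tᵢ≡x with any? (λ j → is-var? (ts j) x)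
    ... | yes (j , tⱼ≡x) = cong (λ C → C ^ gap [ ρ x ]) (same-var-same-ctx j i x tⱼ≡x tᵢ≡x)
    ... | no ∄j          = ⊥-elim (∄j (i , tᵢ≡x))

    exp-p exp-q : Fin m → ℕ
    exp-p i = as i * (n + k) + bs i
    exp-q i = as' i * n + bs' i

    ground-exponents : ∀ i → Ground Sg (ts i) → exp-q i ≡ exp-p i
    ground-exponents i ground with ground-a i ground | ground-b i ground
    ... | aᵢ≡h , a'ᵢ≡h | bᵢ≡b , b'ᵢ≡b' = begin
      as' i * n + bs' i     ≡⟨ cong₂ (λ α β → α * n + β) a'ᵢ≡h b'ᵢ≡b' ⟩
      h * n + b'            ≡⟨ h*n+b'≡h*[n+k]+b h n k k-def b≤b' ⟩
      h * (n + k) + b       ≡⟨ cong₂ (λ α β → α * (n + k) + β) aᵢ≡h bᵢ≡b ⟨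
      as i * (n + k) + bs i ∎
      where open ≡-Reasoning

    shift-ground : ∀ i → Ground Sg (ts i) → ctx i ^ exp-q i [ ts i ⟨ ρ ⟩ ] ≡ ctx i ^ exp-p i [ ts i ⟨ η ⟩ ]
    shift-ground i ground =
      cong₂ (λ e t → ctx i ^ e [ t ]) (ground-exponents i ground)
            (trans (ground-⟨⟩ ground ρ) (sym (ground-⟨⟩ ground η)))

    shift-var : ∀ i → IsVar Sg (ts i) → ctx i ^ exp-q i [ ts i ⟨ ρ ⟩ ] ≡ ctx i ^ exp-p i [ ts i ⟨ η ⟩ ]
    shift-var i (x , tᵢ≡x) with var-a i (x , tᵢ≡x) | var-b i (x , tᵢ≡x)
    ... | aᵢ≡a , a'ᵢ≡a' | bᵢ≡d , b'ᵢ≡d' = begin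
      C ^ exp-q i [ ts i ⟨ ρ ⟩ ]                 ≡⟨ cong₂ (λ e t → C ^ e [ t ]) exp-qᵢ≡ (cong _⟨ ρ ⟩ tᵢ≡x) ⟩
      C ^ (a' * n + d') [ ρ x ]                  ≡⟨ cong (λ e → C ^ e [ ρ x ]) (ℕ.m+[n∸m]≡n var-exponents-≤) ⟨
      C ^ (a * (n + k) + d + gap) [ ρ x ]        ≡⟨ ^-+ C (a * (n + k) + d) gap (ρ x) ⟨
      C ^ (a * (n + k) + d) [ C ^ gap [ ρ x ] ]  ≡⟨ cong (C ^ (a * (n + k) + d) [_]) (η-var tᵢ≡x) ⟨
      C ^ (a * (n + k) + d) [ η x ]              ≡⟨ cong₂ (λ e t → C ^ e [ t ]) exp-pᵢ≡ (cong _⟨ η ⟩ tᵢ≡x) ⟨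
      C ^ exp-p i [ ts i ⟨ η ⟩ ]                 ∎
      where
      open ≡-Reasoning
      C : Ctx1 Sg
      C = ctx i
      exp-qᵢ≡ : exp-q i ≡ a' * n + d'
      exp-qᵢ≡ = cong₂ (λ α β → α * n + β) a'ᵢ≡a' b'ᵢ≡d'
      exp-pᵢ≡ : exp-p i ≡ a * (n + k) + d
      exp-pᵢ≡ = cong₂ (λ α β → α * (n + k) + β) aᵢ≡a bᵢ≡d

    P Q : Fin m → UTm Sg
    P i = ups (cs i) (as i) (bs i) (embU Sg (ts i))
    Q i = ups (cs i) (as' i) (bs' i) (embU Sg (ts i ⟨ ρ ⟩))

    hole-shift : ∀ i → evalU Sg n (Q i) ≡ evalU Sg (n + k) (P i) ⟨ η ⟩
    hole-shift i = begin
      evalU Sg n (Q i)               ≡⟨ cong (ctx i ^ exp-q i [_]) (evalU-embU n (ts i ⟨ ρ ⟩)) ⟩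
      ctx i ^ exp-q i [ ts i ⟨ ρ ⟩ ]  ≡⟨ [ shift-var i , shift-ground i ]′ (var-or-ground i) ⟩
      ctx i ^ exp-p i [ ts i ⟨ η ⟩ ]  ≡⟨ ⟦⟧-⟨⟩ (ctx i ^ exp-p i) _ η ⟨
      ctx i ^ exp-p i [ ts i ] ⟨ η ⟩  ≡⟨ cong (λ t → ctx i ^ exp-p i [ t ] ⟨ η ⟩) (evalU-embU (n + k) (ts i)) ⟨
      evalU Sg (n + k) (P i) ⟨ η ⟩    ∎
      where open ≡-Reasoning

    q≡p⟨η⟩ : _⦅_⦆ Sg q n ≡ _⦅_⦆ Sg p (n + k) ⟨ η ⟩
    q≡p⟨η⟩ = begin
      _⦅_⦆ Sg q n                                 ≡⟨ ∈υ-eval {plugU Sg c Q} inQ n ⟩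
      evalU Sg n (plugU Sg c Q)                   ≡⟨ evalU-plugU n c Q ⟩
      c ⟦ (λ i → evalU Sg n (Q i)) ⟧              ≡⟨ bind-cong c (λ ()) hole-shift ⟩
      c ⟦ (λ i → evalU Sg (n + k) (P i) ⟨ η ⟩) ⟧  ≡⟨ ⟦⟧-⟨⟩ c _ η ⟨
      c ⟦ (λ i → evalU Sg (n + k) (P i)) ⟧ ⟨ η ⟩  ≡⟨ cong _⟨ η ⟩ (evalU-plugU (n + k) c P) ⟨
      evalU Sg (n + k) (plugU Sg c P) ⟨ η ⟩       ≡⟨ cong _⟨ η ⟩ (∈υ-eval {plugU Sg c P} inP (n + k)) ⟨
      _⦅_⦆ Sg p (n + k) ⟨ η ⟩                     ∎
      where open ≡-Reasoning

lemmaA8 : (Sg : Signature) (p q : PTerm Sg) (w : SpecialWitness Sg p q) (n : ℕ) →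
          SpecialWitness.α w ≤ ((+ n) / 1) →
          ∃[ η ] (_⦅_⦆ Sg q n ≡ _⟪_⟫ Sg (_⦅_⦆ Sg p (n + SpecialWitness.k w)) η)
lemmaA8 Sg p q w n α≤n = η , q≡p⟨η⟩
  where open SpecialRule Sg w n α≤n
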